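{- For every integer $k\ge0$, the power series $$h_k(q)=\sum_{n\ge1}(-1)^{n+1}\frac{q^{\frac{n^2+n}{2}}A_k(q^n)}{(1-q^n)^k}$$ has nonnegative coefficients.
   Context: $A_k(t)=\sum_{i=0}^{k-1}A_{k,i}t^i$, where $A_{k,i}$ is the number of permutations of $\{1,\dots,k\}$ with exactly $i$ descents (the Eulerian numbers, satisfying $A_{k,i}=(i+1)A_{k-1,i}+(k-i)A_{k-1,i-1}$); in particular $A_0(t)$ is the empty sum $0$. -}

module Defs where

open import Data.Nat using (ℕ; zero; suc; _∸_; _≡ᵇ_) renaming (_+_ to _+ℕ_; _*_ to _*ℕ_)
open import Data.Nat.Divisibility using (_∣?_)
open import Data.Bool using (if_then_else_)
open import Data.Integer using (ℤ; +_; _+_; _*_; -_)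
open import Relation.Nullary.Decidable using (⌊_⌋)

-- Eulerian numbers A_{k,i}, via the stated recurrence
-- A_{k,i} = (i+1) A_{k-1,i} + (k-i) A_{k-1,i-1}, with A_{1,0} = 1,
-- A_{1,i} = 0 for i ≥ 1, and A_{0,i} = 0 (so A_0(t) = 0).
eulerian : ℕ → ℕ → ℕ
eulerian zero i = 0
eulerian (suc zero) zero = 1
eulerian (suc zero) (suc i) = 0
eulerian (suc (suc k)) zero = eulerian (suc k) zero
eulerian (suc (suc k)) (suc i) =
  (suc (suc i)) *ℕ eulerian (suc k) (suc i) +ℕ ((suc (suc k)) ∸ suc i) *ℕ eulerian (suc k) i

Series : Set
Series = ℕ → ℤ

sumℤ : ℕ → (ℕ → ℤ) → ℤ
sumℤ zero f = + 0
sumℤ (suc n) f = sumℤ n f + f n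

sumS : ℕ → (ℕ → Series) → Series
sumS n F m = sumℤ n (λ i → F i m)

_·_ : ℤ → Series → Series
(c · f) m = c * f m

_⊛_ : Series → Series → Series
(f ⊛ g) m = sumℤ (suc m) (λ i → f i * g (m ∸ i))

infixl 7 _⊛_

mono : ℕ → Series
mono a m = if a ≡ᵇ m then + 1 else + 0

powS : Series → ℕ → Series
powS f zero = mono 0
powS f (suc k) = f ⊛ powS f k

-- 1/(1 - q^n) = Σ_{j ≥ 0} q^{n j}   (for n ≥ 1): coefficient of q^m is 1 iff n ∣ m
geom : ℕ → Series
geom n m = if ⌊ n ∣? m ⌋ then + 1 else + 0

eulerianAt : ℕ → ℕ → Series
eulerianAt k n = sumS k (λ i → (+ eulerian k i) · mono (n *ℕ i))

-- triangular number (n² + n)/2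
tri : ℕ → ℕ
tri zero = 0
tri (suc n) = suc n +ℕ tri n

term : ℕ → ℕ → Series
term k n = mono (tri n) ⊛ eulerianAt k n ⊛ powS (geom n) k

sgn : ℕ → ℤ
sgn zero = - (+ 1)
sgn (suc zero) = + 1
sgn (suc (suc n)) = sgn n

-- The n-th summand is divisible by
-- q^{(n²+n)/2}, and (n²+n)/2 ≥ n > m for n > m, so the coefficient of q^m
-- only receives contributions from 1 ≤ n ≤ m: this sum is exact.
h : ℕ → Series
h k m = sumℤ m (λ j → sgn (suc j) * term k (suc j) m)

-- The coefficient of q^m in the n-th summand vanishes unless 2m = n (n + 1 + 2t) for some t ≥ 0,
-- and then it is the coefficient c(t) of q^t in A_k(q)/(1-q)^k: the summand is q^{n(n+1)/2} times a
-- series in q^n, and substituting q for q^n turns it into A_k(q)/(1-q)^k.  For k ≥ 1 this series is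
-- a nonnegative series times 1/(1-q), so c is nondecreasing.
--
-- Write m = 2^v (2w + 1) and M = 2^{v+1}.  The two factors of 2m = n (n + 1 + 2t) have opposite
-- parity, so every even n that contributes has 2-adic valuation exactly v + 1, i.e. n = M j with j
-- odd.  Pair the negative term of M j with the positive term of j: from (M j)(M j + 1 + 2t) =
-- j (j + 1 + 2t') with t' ≥ t, its coefficient c(t) is at most c(t').

module Submission where

open import Defs
open import Data.Bool using (true; false)
open import Data.Integer as ℤ using (ℤ; +_; _+_; _*_; -_; _-_; _≤_; +≤+)
import Data.Integer.Properties as ℤₚ
open import Data.Nat as ℕ using (ℕ; zero; suc; _∸_; _^_; z≤n; s≤s; NonZero; parity)
import Data.Nat.Properties as ℕₚ
open import Data.Nat.Divisibility
  using (_∣_; _∣?_; divides; 1∣_; ∣-trans; m∣m*n; n∣m*n; ∣m∣n⇒∣m+n; ∣m+n∣m⇒∣n; ∣⇒≤; *-monoʳ-∣; *-cancelˡ-∣)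
open import Data.Nat.Induction using (<-rec)
open import Data.Nat.Primality using (prime[2]; euclidsLemma)
open import Data.Nat.Tactic.RingSolver using (solve-∀)
import Data.Integer.Tactic.RingSolver as ℤ-Ring
open import Data.Parity.Base as ℙ using (Parity; 0ℙ; 1ℙ)
import Data.Parity.Properties as ℙₚ
open import Data.Product using (∃; ∃₂; _×_; _,_; proj₁; proj₂)
open import Data.Sum using (_⊎_; inj₁; inj₂)
open import Function using (_∘_)
open import Relation.Binary.PropositionalEquality
open import Relation.Nullary using (¬_; yes; no; contradiction)

sumℤ-cong : ∀ n {f g : ℕ → ℤ} → (∀ i → i ℕ.< n → f i ≡ g i) → sumℤ n f ≡ sumℤ n g
sumℤ-cong zero     f≡g = refl
sumℤ-cong (suc n) f≡g =
  cong₂ _+_ (sumℤ-cong n (λ i i<n → f≡g i (ℕₚ.m<n⇒m<1+n i<n))) (f≡g n ℕₚ.≤-refl)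

sumℤ-zero : ∀ n {f : ℕ → ℤ} → (∀ i → i ℕ.< n → f i ≡ + 0) → sumℤ n f ≡ + 0
sumℤ-zero n {f} f≡0 = trans (sumℤ-cong n f≡0) (sumℤ-const-zero n)
  where
  sumℤ-const-zero : ∀ n → sumℤ n (λ _ → + 0) ≡ + 0
  sumℤ-const-zero zero    = refl
  sumℤ-const-zero (suc n) = trans (ℤₚ.+-identityʳ _) (sumℤ-const-zero n)

sumℤ-mono-≤ : ∀ n {f g : ℕ → ℤ} → (∀ i → i ℕ.< n → f i ≤ g i) → sumℤ n f ≤ sumℤ n g
sumℤ-mono-≤ zero     f≤g = ℤₚ.≤-refl
sumℤ-mono-≤ (suc n) f≤g =
  ℤₚ.+-mono-≤ (sumℤ-mono-≤ n (λ i i<n → f≤g i (ℕₚ.m<n⇒m<1+n i<n))) (f≤g n ℕₚ.≤-refl)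

sumℤ-nonNeg : ∀ n {f : ℕ → ℤ} → (∀ i → i ℕ.< n → + 0 ≤ f i) → + 0 ≤ sumℤ n f
sumℤ-nonNeg n {f} 0≤f = subst (_≤ sumℤ n f) (sumℤ-zero n (λ _ _ → refl)) (sumℤ-mono-≤ n 0≤f)

sumℤ-split : ∀ a b {f : ℕ → ℤ} → sumℤ (a ℕ.+ b) f ≡ sumℤ a f + sumℤ b (λ i → f (a ℕ.+ i))
sumℤ-split a zero    {f} rewrite ℕₚ.+-identityʳ a = sym (ℤₚ.+-identityʳ _)
sumℤ-split a (suc b) {f} rewrite ℕₚ.+-suc a b | sumℤ-split a b {f} =
  ℤₚ.+-assoc (sumℤ a f) _ _

sumℤ-suc : ∀ n {f : ℕ → ℤ} → sumℤ (suc n) f ≡ f 0 + sumℤ n (f ∘ suc)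
sumℤ-suc n {f} = trans (sumℤ-split 1 n) (cong (_+ sumℤ n (f ∘ suc)) (ℤₚ.+-identityˡ (f 0)))

sumℤ-sub : ∀ n {f g : ℕ → ℤ} → sumℤ n (λ i → f i - g i) ≡ sumℤ n f - sumℤ n g
sumℤ-sub zero    = refl
sumℤ-sub (suc n) {f} {g} rewrite sumℤ-sub n {f} {g} = swap-middle (sumℤ n f) (f n) (sumℤ n g) (g n)
  where
  swap-middle : ∀ a b c d → (a - c) + (b - d) ≡ (a + b) - (c + d)
  swap-middle = ℤ-Ring.solve-∀

sumℤ-pad : ∀ a b {f : ℕ → ℤ} → a ℕ.≤ b → (∀ i → a ℕ.≤ i → f i ≡ + 0) → sumℤ b f ≡ sumℤ a f
sumℤ-pad a b {f} a≤b f≡0 with ℕₚ.m≤n⇒∃[o]m+o≡n a≤b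
... | o , refl = begin
  sumℤ (a ℕ.+ o) f                          ≡⟨ sumℤ-split a o ⟩
  sumℤ a f + sumℤ o (λ i → f (a ℕ.+ i))    ≡⟨ cong (λ x → sumℤ a f + x) (sumℤ-zero o (λ i _ → f≡0 _ (ℕₚ.m≤m+n a i))) ⟩
  sumℤ a f + + 0                            ≡⟨ ℤₚ.+-identityʳ _ ⟩
  sumℤ a f                                  ∎
  where open ≡-Reasoning

-- Coefficients of the summands

mono-refl : ∀ a → mono a a ≡ + 1
mono-refl zero    = refl
mono-refl (suc a) = mono-refl a

mono-≢ : ∀ {a b} → a ≢ b → mono a b ≡ + 0
mono-≢ {zero}  {zero}  a≢b = contradiction refl a≢b
mono-≢ {zero}  {suc b} _   = refl
mono-≢ {suc a} {zero}  _   = refl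
mono-≢ {suc a} {suc b} a≢b = mono-≢ (a≢b ∘ cong suc)

mono-shift : ∀ a i → mono a (a ℕ.+ i) ≡ mono 0 i
mono-shift zero    i = refl
mono-shift (suc a) i = mono-shift a i

mono-dilate : ∀ n .{{_ : NonZero n}} i t → mono (n ℕ.* i) (n ℕ.* t) ≡ mono i t
mono-dilate n i t with i ℕ.≟ t
... | yes refl = trans (mono-refl (n ℕ.* i)) (sym (mono-refl i))
... | no  i≢t  = trans (mono-≢ (i≢t ∘ ℕₚ.*-cancelˡ-≡ i t n)) (sym (mono-≢ i≢t))

geom-multiple : ∀ n {m} → n ∣ m → geom n m ≡ + 1
geom-multiple n {m} n∣m with n ∣? m
... | yes _   = refl
... | no  n∤m = contradiction n∣m n∤m

⊛-cong : ∀ {f f′ g g′} → f ≗ f′ → g ≗ g′ → f ⊛ g ≗ f′ ⊛ g′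
⊛-cong f≗f′ g≗g′ m = sumℤ-cong (suc m) (λ i _ → cong₂ _*_ (f≗f′ i) (g≗g′ (m ∸ i)))

⊛-congˡ : ∀ {f f′} g → f ≗ f′ → f ⊛ g ≗ f′ ⊛ g
⊛-congˡ {f} {f′} g f≗f′ = ⊛-cong {f} {f′} {g} {g} f≗f′ (λ _ → refl)

⊛-congʳ : ∀ f {g g′} → g ≗ g′ → f ⊛ g ≗ f ⊛ g′
⊛-congʳ f {g} {g′} = ⊛-cong {f} {f} {g} {g′} (λ _ → refl)

powS-cong : ∀ {f g} → f ≗ g → ∀ k → powS f k ≗ powS g k
powS-cong f≗g zero    = λ _ → refl
powS-cong f≗g (suc k) = ⊛-cong f≗g (powS-cong f≗g k)

mono0-⊛ : ∀ f → mono 0 ⊛ f ≗ f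
mono0-⊛ f m = begin
  (mono 0 ⊛ f) m                                    ≡⟨ sumℤ-suc m ⟩
  + 1 * f m + sumℤ m (λ i → + 0 * f (m ∸ suc i))   ≡⟨ cong₂ _+_ (ℤₚ.*-identityˡ (f m)) (sumℤ-zero m (λ _ _ → refl)) ⟩
  f m + + 0                                         ≡⟨ ℤₚ.+-identityʳ (f m) ⟩
  f m                                               ∎
  where open ≡-Reasoning

⊛-vanish : ∀ a {f g} → (∀ i → i ℕ.< a → f i ≡ + 0) → ∀ m → m ℕ.< a → (f ⊛ g) m ≡ + 0
⊛-vanish a {f} {g} f≡0 m m<a =
  sumℤ-zero (suc m) (λ i i≤m → cong (_* g (m ∸ i)) (f≡0 i (ℕₚ.<-≤-trans i≤m m<a)))

⊛-shift : ∀ a {f g} → (∀ i → i ℕ.< a → f i ≡ + 0) →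
          ∀ m → (f ⊛ g) (a ℕ.+ m) ≡ ((f ∘ (a ℕ.+_)) ⊛ g) m
⊛-shift a {f} {g} f≡0 m = begin
  sumℤ (suc (a ℕ.+ m)) H                                   ≡⟨ cong (λ n → sumℤ n H) (sym (ℕₚ.+-suc a m)) ⟩
  sumℤ (a ℕ.+ suc m) H                                     ≡⟨ sumℤ-split a (suc m) ⟩
  sumℤ a H + sumℤ (suc m) (λ i → H (a ℕ.+ i))             ≡⟨ cong₂ _+_ head-zero tail-shift ⟩
  + 0 + ((f ∘ (a ℕ.+_)) ⊛ g) m                             ≡⟨ ℤₚ.+-identityˡ _ ⟩
  ((f ∘ (a ℕ.+_)) ⊛ g) m                                   ∎
  where
  open ≡-Reasoning
  H : ℕ → ℤ
  H i = f i * g (a ℕ.+ m ∸ i)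
  head-zero : sumℤ a H ≡ + 0
  head-zero = sumℤ-zero a (λ i i<a → cong (_* _) (f≡0 i i<a))
  tail-shift : sumℤ (suc m) (λ i → H (a ℕ.+ i)) ≡ ((f ∘ (a ℕ.+_)) ⊛ g) m
  tail-shift = sumℤ-cong (suc m) (λ i _ → cong (λ j → f (a ℕ.+ i) * g j) (ℕₚ.[m+n]∸[m+o]≡n∸o a m i))

mono⊛-vanish : ∀ a f m → m ℕ.< a → (mono a ⊛ f) m ≡ + 0
mono⊛-vanish a f = ⊛-vanish a {g = f} (λ i i<a → mono-≢ (ℕₚ.>⇒≢ i<a))

mono⊛-shift : ∀ a f m → (mono a ⊛ f) (a ℕ.+ m) ≡ f m
mono⊛-shift a f m = trans (⊛-shift a {g = f} (λ i i<a → mono-≢ (ℕₚ.>⇒≢ i<a)) m)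
                          (trans (⊛-congˡ f (mono-shift a) m) (mono0-⊛ f m))

NonNeg : Series → Set
NonNeg f = ∀ m → + 0 ≤ f m

*-nonNeg : ∀ {a b} → + 0 ≤ a → + 0 ≤ b → + 0 ≤ a * b
*-nonNeg {+ a} {+ b} _ _ = subst (+ 0 ≤_) (ℤₚ.pos-* a b) (+≤+ z≤n)

nonNeg-mono : ∀ a → NonNeg (mono a)
nonNeg-mono a m with a ℕ.≡ᵇ m
... | true  = +≤+ z≤n
... | false = +≤+ z≤n

nonNeg-geom : ∀ n → NonNeg (geom n)
nonNeg-geom n m with n ∣? m
... | yes _ = +≤+ z≤n
... | no  _ = +≤+ z≤n

nonNeg-⊛ : ∀ {f g} → NonNeg f → NonNeg g → NonNeg (f ⊛ g)
nonNeg-⊛ 0≤f 0≤g m = sumℤ-nonNeg (suc m) (λ i _ → *-nonNeg (0≤f i) (0≤g (m ∸ i)))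

nonNeg-powS : ∀ {f} → NonNeg f → ∀ k → NonNeg (powS f k)
nonNeg-powS 0≤f zero    = nonNeg-mono 0
nonNeg-powS 0≤f (suc k) = nonNeg-⊛ 0≤f (nonNeg-powS 0≤f k)

nonNeg-eulerianAt : ∀ k n → NonNeg (eulerianAt k n)
nonNeg-eulerianAt k n m = sumℤ-nonNeg k (λ i _ → *-nonNeg {+ eulerian k i} (+≤+ z≤n) (nonNeg-mono (n ℕ.* i) m))

eulerianRatio : ℕ → ℕ → Series
eulerianRatio k n = eulerianAt k n ⊛ powS (geom n) k

nonNeg-term : ∀ k n → NonNeg (term k n)
nonNeg-term k n = nonNeg-⊛ (nonNeg-⊛ (nonNeg-mono (tri n)) (nonNeg-eulerianAt k n))
                           (nonNeg-powS (nonNeg-geom n) k)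

term-below : ∀ k n m → m ℕ.< tri n → term k n m ≡ + 0
term-below k n = ⊛-vanish (tri n) {g = powS (geom n) k} (mono⊛-vanish (tri n) (eulerianAt k n))

term-shift : ∀ k n m → term k n (tri n ℕ.+ m) ≡ eulerianRatio k n m
term-shift k n m =
  trans (⊛-shift (tri n) {g = powS (geom n) k} (mono⊛-vanish (tri n) (eulerianAt k n)) m)
        (⊛-congˡ (powS (geom n) k) (mono⊛-shift (tri n) (eulerianAt k n)) m)

OnMultiples : ℕ → Series → Set
OnMultiples n f = ∀ m → ¬ n ∣ m → f m ≡ + 0

sumℤ-multiples-suc : ∀ {n} .{{_ : NonZero n}} {f : ℕ → ℤ} → OnMultiples n f →
                     ∀ t → sumℤ (n ℕ.* t) (f ∘ suc) ≡ sumℤ t (λ j → f (n ℕ.* suc j))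
sumℤ-multiples-suc {n} f-on zero rewrite ℕₚ.*-zeroʳ n = refl
sumℤ-multiples-suc {n@(suc n′)} {f} f-on (suc t) = begin
  sumℤ (n ℕ.* suc t) (f ∘ suc)
    ≡⟨ cong (λ l → sumℤ l (f ∘ suc)) nt+n ⟩
  sumℤ (n ℕ.* t ℕ.+ n) (f ∘ suc)
    ≡⟨ sumℤ-split (n ℕ.* t) n ⟩
  sumℤ (n ℕ.* t) (f ∘ suc) + (sumℤ n′ block + f (suc (n ℕ.* t ℕ.+ n′)))
    ≡⟨ cong₂ _+_ (sumℤ-multiples-suc f-on t) (cong₂ _+_ block-zero last) ⟩
  sumℤ t (λ j → f (n ℕ.* suc j)) + (+ 0 + f (n ℕ.* suc t))
    ≡⟨ cong (λ x → sumℤ t (λ j → f (n ℕ.* suc j)) + x) (ℤₚ.+-identityˡ _) ⟩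
  sumℤ (suc t) (λ j → f (n ℕ.* suc j))
    ∎
  where
  open ≡-Reasoning
  block : ℕ → ℤ
  block i = f (suc (n ℕ.* t ℕ.+ i))
  nt+n : n ℕ.* suc t ≡ n ℕ.* t ℕ.+ n
  nt+n = trans (ℕₚ.*-suc n t) (ℕₚ.+-comm n (n ℕ.* t))
  n∤ : ∀ i → i ℕ.< n′ → ¬ n ∣ suc (n ℕ.* t ℕ.+ i)
  n∤ i i<n′ n∣ = ℕₚ.<⇒≱ (s≤s i<n′)
    (∣⇒≤ (∣m+n∣m⇒∣n (subst (n ∣_) (sym (ℕₚ.+-suc (n ℕ.* t) i)) n∣) (m∣m*n t)))
  block-zero : sumℤ n′ block ≡ + 0
  block-zero = sumℤ-zero n′ (λ i i<n′ → f-on _ (n∤ i i<n′))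
  last : f (suc (n ℕ.* t ℕ.+ n′)) ≡ f (n ℕ.* suc t)
  last = cong f (trans (sym (ℕₚ.+-suc _ n′)) (sym nt+n))

sumℤ-multiples : ∀ {n} .{{_ : NonZero n}} {f : ℕ → ℤ} → OnMultiples n f →
                 ∀ t → sumℤ (suc (n ℕ.* t)) f ≡ sumℤ (suc t) (f ∘ (n ℕ.*_))
sumℤ-multiples {n} {f} f-on t = begin
  sumℤ (suc (n ℕ.* t)) f
    ≡⟨ sumℤ-suc (n ℕ.* t) ⟩
  f 0 + sumℤ (n ℕ.* t) (f ∘ suc)
    ≡⟨ cong₂ _+_ (cong f (sym (ℕₚ.*-zeroʳ n))) (sumℤ-multiples-suc f-on t) ⟩
  f (n ℕ.* 0) + sumℤ t (λ j → f (n ℕ.* suc j))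
    ≡⟨ sumℤ-suc t ⟨
  sumℤ (suc t) (f ∘ (n ℕ.*_))
    ∎
  where open ≡-Reasoning

onMultiples-⊛ : ∀ {n f g} → OnMultiples n f → OnMultiples n g → OnMultiples n (f ⊛ g)
onMultiples-⊛ {n} {f} {g} f-on g-on m n∤m = sumℤ-zero (suc m) vanishes
  where
  vanishes : ∀ i → i ℕ.< suc m → f i * g (m ∸ i) ≡ + 0
  vanishes i (s≤s i≤m) with n ∣? i
  ... | no  n∤i = cong (_* g (m ∸ i)) (f-on i n∤i)
  ... | yes n∣i = trans (cong (f i *_) (g-on (m ∸ i) (n∤m ∘ n∣m))) (ℤₚ.*-zeroʳ (f i))
    where
    n∣m : n ∣ m ∸ i → n ∣ m
    n∣m n∣m∸i = subst (n ∣_) (ℕₚ.m+[n∸m]≡n i≤m) (∣m∣n⇒∣m+n n∣i n∣m∸i)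

⊛-dilate : ∀ {n} .{{_ : NonZero n}} {f g} → OnMultiples n f → OnMultiples n g →
           ∀ t → (f ⊛ g) (n ℕ.* t) ≡ ((f ∘ (n ℕ.*_)) ⊛ (g ∘ (n ℕ.*_))) t
⊛-dilate {n} {f = f} {g} f-on g-on t =
  trans (sumℤ-multiples (λ i n∤i → cong (_* g (n ℕ.* t ∸ i)) (f-on i n∤i)) t)
        (sumℤ-cong (suc t) (λ j _ → cong (λ l → f (n ℕ.* j) * g l) (sym (ℕₚ.*-distribˡ-∸ n t j))))

onMultiples-mono : ∀ n i → OnMultiples n (mono (n ℕ.* i))
onMultiples-mono n i m n∤m = mono-≢ (λ ni≡m → n∤m (subst (n ∣_) ni≡m (m∣m*n i)))

onMultiples-geom : ∀ n → OnMultiples n (geom n)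
onMultiples-geom n m n∤m with n ∣? m
... | yes n∣m = contradiction n∣m n∤m
... | no  _   = refl

onMultiples-powS : ∀ {n f} → OnMultiples n f → ∀ k → OnMultiples n (powS f k)
onMultiples-powS {n} f-on zero = subst (λ a → OnMultiples n (mono a)) (ℕₚ.*-zeroʳ n) (onMultiples-mono n 0)
onMultiples-powS f-on (suc k) = onMultiples-⊛ f-on (onMultiples-powS f-on k)

onMultiples-eulerianAt : ∀ k n → OnMultiples n (eulerianAt k n)
onMultiples-eulerianAt k n m n∤m =
  sumℤ-zero k (λ i _ → trans (cong (+ eulerian k i *_) (onMultiples-mono n i m n∤m)) (ℤₚ.*-zeroʳ (+ eulerian k i)))

onMultiples-eulerianRatio : ∀ k n → OnMultiples n (eulerianRatio k n)
onMultiples-eulerianRatio k n =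
  onMultiples-⊛ (onMultiples-eulerianAt k n) (onMultiples-powS (onMultiples-geom n) k)

powS-dilate : ∀ {n} .{{_ : NonZero n}} {f} → OnMultiples n f →
              ∀ k t → powS f k (n ℕ.* t) ≡ powS (f ∘ (n ℕ.*_)) k t
powS-dilate {n} f-on zero t = trans (cong (λ a → mono a (n ℕ.* t)) (sym (ℕₚ.*-zeroʳ n))) (mono-dilate n 0 t)
powS-dilate {n} {f} f-on (suc k) t =
  trans (⊛-dilate f-on (onMultiples-powS f-on k) t) (⊛-congʳ (f ∘ (n ℕ.*_)) (powS-dilate f-on k) t)

eulerianAt-dilate : ∀ k n .{{_ : NonZero n}} t → eulerianAt k n (n ℕ.* t) ≡ eulerianAt k 1 t
eulerianAt-dilate k n t = sumℤ-cong k (λ i _ → cong (+ eulerian k i *_)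
  (trans (mono-dilate n i t) (cong (λ a → mono a t) (sym (ℕₚ.*-identityˡ i)))))

geom-dilate : ∀ n t → geom n (n ℕ.* t) ≡ geom 1 t
geom-dilate n t = trans (geom-multiple n (m∣m*n t)) (sym (geom-multiple 1 (1∣ t)))

eulerianRatio-dilate : ∀ k n .{{_ : NonZero n}} t → eulerianRatio k n (n ℕ.* t) ≡ eulerianRatio k 1 t
eulerianRatio-dilate k n t =
  trans (⊛-dilate (onMultiples-eulerianAt k n) (onMultiples-powS (onMultiples-geom n) k) t)
        (⊛-cong (eulerianAt-dilate k n) powS-geom-dilate t)
  where
  powS-geom-dilate : ∀ s → powS (geom n) k (n ℕ.* s) ≡ powS (geom 1) k s
  powS-geom-dilate s = trans (powS-dilate (onMultiples-geom n) k s) (powS-cong (geom-dilate n) k s)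

term-value : ∀ k n .{{_ : NonZero n}} t → term k n (tri n ℕ.+ n ℕ.* t) ≡ eulerianRatio k 1 t
term-value k n t = trans (term-shift k n (n ℕ.* t)) (eulerianRatio-dilate k n t)

term-support : ∀ k n m → term k n m ≡ + 0 ⊎ ∃ λ t → tri n ℕ.+ n ℕ.* t ≡ m
term-support k n m with tri n ℕ.≤? m
... | no  tri≰m = inj₁ (term-below k n m (ℕₚ.≰⇒> tri≰m))
... | yes tri≤m with ℕₚ.m≤n⇒∃[o]m+o≡n tri≤m
...   | r , refl with n ∣? r
...     | yes (divides t refl) = inj₂ (t , cong (tri n ℕ.+_) (ℕₚ.*-comm n t))
...     | no  n∤r              = inj₁ (trans (term-shift k n r) (onMultiples-eulerianRatio k n r n∤r))

-- Monotonicity of the coefficients of A_k(q)/(1-q)^k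

Increasing : Series → Set
Increasing f = ∀ t → f t ≤ f (suc t)

increasing-+ : ∀ {f} → Increasing f → ∀ t d → f t ≤ f (t ℕ.+ d)
increasing-+ f↑ t zero    rewrite ℕₚ.+-identityʳ t = ℤₚ.≤-refl
increasing-+ f↑ t (suc d) rewrite ℕₚ.+-suc t d = ℤₚ.≤-trans (increasing-+ f↑ t d) (f↑ (t ℕ.+ d))

geom1-⊛-increasing : ∀ {g} → NonNeg g → Increasing (geom 1 ⊛ g)
geom1-⊛-increasing {g} 0≤g t =
  subst ((geom 1 ⊛ g) t ≤_) (sym peel) (ℤₚ.i≤j+i _ _ {{ℤ.nonNegative 0≤head}})
  where
  0≤head : + 0 ≤ geom 1 0 * g (suc t)
  0≤head = *-nonNeg (nonNeg-geom 1 0) (0≤g (suc t))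
  geom1-shift : ∀ i → geom 1 (suc i) ≡ geom 1 i
  geom1-shift i = trans (geom-multiple 1 (1∣ suc i)) (sym (geom-multiple 1 (1∣ i)))
  peel : (geom 1 ⊛ g) (suc t) ≡ geom 1 0 * g (suc t) + (geom 1 ⊛ g) t
  peel = trans (sumℤ-suc (suc t))
               (cong (_+_ (geom 1 0 * g (suc t))) (sumℤ-cong (suc t) (λ i _ → cong (_* g (t ∸ i)) (geom1-shift i))))

⊛-increasing : ∀ {f g} → NonNeg f → NonNeg g → Increasing g → Increasing (f ⊛ g)
⊛-increasing {f} {g} 0≤f 0≤g g↑ t = begin
  sumℤ (suc t) (λ i → f i * g (t ∸ i))                                   ≤⟨ sumℤ-mono-≤ (suc t) step ⟩
  sumℤ (suc t) (λ i → f i * g (suc t ∸ i))                               ≤⟨ ℤₚ.i≤i+j _ _ {{ℤ.nonNegative 0≤last}} ⟩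
  sumℤ (suc t) (λ i → f i * g (suc t ∸ i)) + f (suc t) * g 0             ≡⟨ cong (λ l → init + f (suc t) * g l) (ℕₚ.n∸n≡0 t) ⟨
  (f ⊛ g) (suc t)                                                        ∎
  where
  open ℤₚ.≤-Reasoning
  init : ℤ
  init = sumℤ (suc t) (λ i → f i * g (suc t ∸ i))
  0≤last : + 0 ≤ f (suc t) * g 0
  0≤last = *-nonNeg (0≤f (suc t)) (0≤g 0)
  step : ∀ i → i ℕ.< suc t → f i * g (t ∸ i) ≤ f i * g (suc t ∸ i)
  step i (s≤s i≤t) = ℤₚ.*-monoˡ-≤-nonNeg (f i) {{ℤ.nonNegative (0≤f i)}}
    (subst (g (t ∸ i) ≤_) (cong g (sym (ℕₚ.+-∸-assoc 1 i≤t))) (g↑ (t ∸ i)))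

eulerianRatio-increasing : ∀ k → Increasing (eulerianRatio k 1)
eulerianRatio-increasing zero t =
  ℤₚ.≤-reflexive (trans (sumℤ-zero (suc t) (λ _ _ → refl)) (sym (sumℤ-zero (suc (suc t)) (λ _ _ → refl))))
eulerianRatio-increasing (suc k) =
  ⊛-increasing (nonNeg-eulerianAt (suc k) 1) (nonNeg-powS (nonNeg-geom 1) (suc k))
               (geom1-⊛-increasing (nonNeg-powS (nonNeg-geom 1) k))

-- Triangular numbers and 2-adic valuations

tri-double : ∀ n → 2 ℕ.* tri n ≡ n ℕ.* suc n
tri-double zero    = refl
tri-double (suc n) = begin
  2 ℕ.* (suc n ℕ.+ tri n)            ≡⟨ ℕₚ.*-distribˡ-+ 2 (suc n) (tri n) ⟩
  2 ℕ.* suc n ℕ.+ 2 ℕ.* tri n        ≡⟨ cong (2 ℕ.* suc n ℕ.+_) (tri-double n) ⟩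
  2 ℕ.* suc n ℕ.+ n ℕ.* suc n        ≡⟨ factor n ⟩
  suc n ℕ.* suc (suc n)              ∎
  where
  open ≡-Reasoning
  factor : ∀ n → 2 ℕ.* suc n ℕ.+ n ℕ.* suc n ≡ suc n ℕ.* suc (suc n)
  factor = solve-∀

contribution-double : ∀ n t → 2 ℕ.* (tri n ℕ.+ n ℕ.* t) ≡ n ℕ.* suc (n ℕ.+ 2 ℕ.* t)
contribution-double n t = begin
  2 ℕ.* (tri n ℕ.+ n ℕ.* t)          ≡⟨ ℕₚ.*-distribˡ-+ 2 (tri n) (n ℕ.* t) ⟩
  2 ℕ.* tri n ℕ.+ 2 ℕ.* (n ℕ.* t)    ≡⟨ cong₂ ℕ._+_ (tri-double n) (regroup n t) ⟩
  n ℕ.* suc n ℕ.+ n ℕ.* (2 ℕ.* t)    ≡⟨ ℕₚ.*-distribˡ-+ n (suc n) (2 ℕ.* t) ⟨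
  n ℕ.* suc (n ℕ.+ 2 ℕ.* t)          ∎
  where
  open ≡-Reasoning
  regroup : ∀ n t → 2 ℕ.* (n ℕ.* t) ≡ n ℕ.* (2 ℕ.* t)
  regroup = solve-∀

n≤tri : ∀ n → n ℕ.≤ tri n
n≤tri zero    = z≤n
n≤tri (suc n) = ℕₚ.m≤m+n (suc n) (tri n)

evenOrOdd : ∀ n → (∃ λ q → n ≡ 2 ℕ.* q) ⊎ (∃ λ q → n ≡ suc (2 ℕ.* q))
evenOrOdd zero = inj₁ (0 , refl)
evenOrOdd (suc n) with evenOrOdd n
... | inj₁ (q , refl) = inj₂ (q , refl)
... | inj₂ (q , refl) = inj₁ (suc q , cong suc (sym (ℕₚ.+-suc q (q ℕ.+ 0))))

odd-part : ∀ m → ∃₂ λ v w → suc m ≡ 2 ^ v ℕ.* suc (2 ℕ.* w)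
odd-part = <-rec _ step
  where
  step : ∀ m → (∀ {q} → q ℕ.< m → ∃₂ λ v w → suc q ≡ 2 ^ v ℕ.* suc (2 ℕ.* w)) →
         ∃₂ λ v w → suc m ≡ 2 ^ v ℕ.* suc (2 ℕ.* w)
  step m rec with evenOrOdd (suc m)
  ... | inj₂ (w , e)       = 0 , w , trans e (sym (ℕₚ.*-identityˡ _))
  ... | inj₁ (suc q , e)   with rec (subst (q ℕ.<_) (sym (ℕₚ.suc-injective e)) (ℕₚ.m<m+n q ℕ.z<s))
  ...   | v , w , e′       = suc v , w , trans e (trans (cong (2 ℕ.*_) e′) (sym (ℕₚ.*-assoc 2 (2 ^ v) _)))

2∤odd : ∀ w → ¬ 2 ∣ suc (2 ℕ.* w)
2∤odd w (divides q e) = ℕₚ.even≢odd q w (trans (ℕₚ.*-comm 2 q) (sym e))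

pow2∣*odd⇒pow2∣ : ∀ a {n w} → 2 ^ a ∣ n ℕ.* suc (2 ℕ.* w) → 2 ^ a ∣ n
pow2∣*odd⇒pow2∣ zero    {n}     _ = 1∣ n
pow2∣*odd⇒pow2∣ (suc a) {n} {w} d with euclidsLemma n (suc (2 ℕ.* w)) prime[2] (∣-trans (m∣m*n (2 ^ a)) d)
... | inj₂ 2∣odd = contradiction 2∣odd (2∤odd w)
... | inj₁ (divides q refl) = subst (2 ^ suc a ∣_) (ℕₚ.*-comm 2 q)
  (*-monoʳ-∣ 2 (pow2∣*odd⇒pow2∣ a {q} {w} (*-cancelˡ-∣ 2 (subst (2 ^ suc a ∣_) (regroup q _) d))))
  where
  regroup : ∀ q o → q ℕ.* 2 ℕ.* o ≡ 2 ℕ.* (q ℕ.* o)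
  regroup = solve-∀

pow2-exact : ∀ a {n b w} → n ℕ.* suc (2 ℕ.* b) ≡ 2 ^ a ℕ.* suc (2 ℕ.* w) →
             2 ^ a ∣ n × ¬ 2 ^ suc a ∣ n
pow2-exact a {n} {b} {w} e = pow2∣*odd⇒pow2∣ a {n} {b} (subst (2 ^ a ∣_) (sym e) (m∣m*n _)) , too-large
  where
  too-large : ¬ 2 ^ suc a ∣ n
  too-large d = 2∤odd w (*-cancelˡ-∣ (2 ^ a) {{ℕₚ.m^n≢0 2 a}}
    (subst₂ _∣_ (ℕₚ.*-comm 2 (2 ^ a)) e (∣-trans d (m∣m*n _))))

even-contributor : ∀ {n t m v w} → 2 ∣ n → tri n ℕ.+ n ℕ.* t ≡ m → m ≡ 2 ^ v ℕ.* suc (2 ℕ.* w) →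
                   2 ^ suc v ∣ n × ¬ 2 ^ suc (suc v) ∣ n
even-contributor {t = t} {m} {v} {w} (divides q refl) contributes m≡ = pow2-exact (suc v) {b = q ℕ.+ t} {w} (begin
  n ℕ.* suc (2 ℕ.* (q ℕ.+ t))        ≡⟨ cong (λ x → n ℕ.* suc x) (regroup q t) ⟩
  n ℕ.* suc (n ℕ.+ 2 ℕ.* t)          ≡⟨ contribution-double n t ⟨
  2 ℕ.* (tri n ℕ.+ n ℕ.* t)          ≡⟨ cong (2 ℕ.*_) (trans contributes m≡) ⟩
  2 ℕ.* (2 ^ v ℕ.* suc (2 ℕ.* w))    ≡⟨ ℕₚ.*-assoc 2 (2 ^ v) _ ⟨
  2 ^ suc v ℕ.* suc (2 ℕ.* w)        ∎)
  where
  open ≡-Reasoning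
  n = q ℕ.* 2
  regroup : ∀ q t → 2 ℕ.* (q ℕ.+ t) ≡ q ℕ.* 2 ℕ.+ 2 ℕ.* t
  regroup = solve-∀

-- D is chosen so that j + 1 + 2 (t + D) = 2d (2dj + 1 + 2t): then both sides, doubled, are
-- 2dj (2dj + 1 + 2t).
odd-rescale : ∀ d .{{_ : NonZero d}} w t → let j = suc (2 ℕ.* w) in
              ∃ λ D → tri (2 ℕ.* d ℕ.* j) ℕ.+ 2 ℕ.* d ℕ.* j ℕ.* t ≡ tri j ℕ.+ j ℕ.* (t ℕ.+ D)
odd-rescale (suc e) w t = D , ℕₚ.*-cancelˡ-≡ _ _ 2 (begin
  2 ℕ.* (tri X ℕ.+ X ℕ.* t)          ≡⟨ contribution-double X t ⟩
  X ℕ.* suc (X ℕ.+ 2 ℕ.* t)          ≡⟨ expand e w t ⟩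
  j ℕ.* suc (j ℕ.+ 2 ℕ.* (t ℕ.+ D))  ≡⟨ contribution-double j (t ℕ.+ D) ⟨
  2 ℕ.* (tri j ℕ.+ j ℕ.* (t ℕ.+ D))  ∎)
  where
  open ≡-Reasoning
  j X D : ℕ
  j = suc (2 ℕ.* w)
  X = 2 ℕ.* suc e ℕ.* j
  D = e ℕ.* (X ℕ.+ 1 ℕ.+ 2 ℕ.* t) ℕ.+ t ℕ.+ 4 ℕ.* e ℕ.* w ℕ.+ 2 ℕ.* e ℕ.+ 3 ℕ.* w ℕ.+ 2
  expand : ∀ e w t →
    2 ℕ.* suc e ℕ.* suc (2 ℕ.* w) ℕ.* suc (2 ℕ.* suc e ℕ.* suc (2 ℕ.* w) ℕ.+ 2 ℕ.* t) ≡
    suc (2 ℕ.* w) ℕ.* suc (suc (2 ℕ.* w) ℕ.+ 2 ℕ.* (t ℕ.+ (e ℕ.* (2 ℕ.* suc e ℕ.* suc (2 ℕ.* w) ℕ.+ 1 ℕ.+ 2 ℕ.* t)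
      ℕ.+ t ℕ.+ 4 ℕ.* e ℕ.* w ℕ.+ 2 ℕ.* e ℕ.+ 3 ℕ.* w ℕ.+ 2)))
  expand = solve-∀

-- The alternating sum, split by parity

even⇒parity≡0ℙ : ∀ {n} → 2 ∣ n → parity n ≡ 0ℙ
even⇒parity≡0ℙ (divides q refl) = trans (ℙₚ.*-homo-* q 2) (ℙₚ.*-zeroʳ (parity q))

parity-odd : ∀ q → parity (suc (2 ℕ.* q)) ≡ 1ℙ
parity-odd q = trans (ℙₚ.+-homo-+ 1 (2 ℕ.* q)) (cong (1ℙ ℙ.+_) (even⇒parity≡0ℙ (m∣m*n q)))

byParity : Parity → ℤ → ℤ → ℤ
byParity 0ℙ x _ = x
byParity 1ℙ _ y = y

evenPart oddPart : Series → Series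
evenPart f n = byParity (parity n) (f n) (+ 0)
oddPart  f n = byParity (parity n) (+ 0) (f n)

sgn-split : ∀ n x → sgn n * x ≡ byParity (parity n) (+ 0) x - byParity (parity n) x (+ 0)
sgn-split zero          x = trans (ℤₚ.-1*i≡-i x) (sym (ℤₚ.+-identityˡ (- x)))
sgn-split (suc zero)    x = trans (ℤₚ.*-identityˡ x) (sym (ℤₚ.+-identityʳ x))
sgn-split (suc (suc n)) x = sgn-split n x

evenPart-even : ∀ f {n} → parity n ≡ 0ℙ → evenPart f n ≡ f n
evenPart-even f e rewrite e = refl

evenPart-odd : ∀ f {n} → parity n ≡ 1ℙ → evenPart f n ≡ + 0
evenPart-odd f e rewrite e = refl

evenPart-zero : ∀ f {n} → f n ≡ + 0 → evenPart f n ≡ + 0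
evenPart-zero f {n} f≡0 with parity n
... | 0ℙ = f≡0
... | 1ℙ = refl

oddPart-even : ∀ f {n} → parity n ≡ 0ℙ → oddPart f n ≡ + 0
oddPart-even f e rewrite e = refl

oddPart-odd : ∀ f {n} → parity n ≡ 1ℙ → oddPart f n ≡ f n
oddPart-odd f e rewrite e = refl

module OddEvenPairing (k m v w : ℕ) (m≡ : m ≡ 2 ^ v ℕ.* suc (2 ℕ.* w)) where

  τ : ℕ → ℤ
  τ n = term k n m

  M : ℕ
  M = 2 ^ suc v

  instance
    M≢0 : NonZero M
    M≢0 = ℕₚ.m^n≢0 2 (suc v)

  τ-beyond : ∀ n → m ℕ.< n → τ n ≡ + 0
  τ-beyond n m<n with term-support k n m
  ... | inj₁ τ≡0 = τ≡0
  ... | inj₂ (t , e) = contradiction (ℕₚ.≤-trans (n≤tri n) (ℕₚ.≤-trans (ℕₚ.m≤m+n _ _) (ℕₚ.≤-reflexive e)))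
                                     (ℕₚ.<⇒≱ m<n)

  evenPart-onMultiples : OnMultiples M (evenPart τ)
  evenPart-onMultiples x M∤x with evenOrOdd x
  ... | inj₂ (q , refl) = evenPart-odd τ (parity-odd q)
  ... | inj₁ (q , refl) with term-support k (2 ℕ.* q) m
  ...   | inj₁ τ≡0    = evenPart-zero τ τ≡0
  ...   | inj₂ (t , e) = contradiction (proj₁ (even-contributor {v = v} {w = w} (m∣m*n q) e m≡)) M∤x

  evenParts-reindex : sumℤ m (evenPart τ ∘ suc) ≡ sumℤ m (λ j → evenPart τ (M ℕ.* suc j))
  evenParts-reindex =
    trans (sym (sumℤ-pad m (M ℕ.* m) (ℕₚ.m≤n*m m M) (λ i m≤i → evenPart-zero τ (τ-beyond (suc i) (s≤s m≤i)))))
          (sumℤ-multiples-suc evenPart-onMultiples m)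

  evenPart-M* : ∀ x → evenPart τ (M ℕ.* x) ≡ τ (M ℕ.* x)
  evenPart-M* x = evenPart-even τ (even⇒parity≡0ℙ (∣-trans (m∣m*n (2 ^ v)) (m∣m*n x)))

  τ-M*even : ∀ q → τ (M ℕ.* (2 ℕ.* q)) ≡ + 0
  τ-M*even q with term-support k (M ℕ.* (2 ℕ.* q)) m
  ... | inj₁ τ≡0    = τ≡0
  ... | inj₂ (t , e) =
    contradiction 2M∣ (proj₂ (even-contributor {v = v} {w = w} (∣-trans (m∣m*n q) (n∣m*n M)) e m≡))
    where
    2M∣ : 2 ^ suc (suc v) ∣ M ℕ.* (2 ℕ.* q)
    2M∣ = subst (_∣ M ℕ.* (2 ℕ.* q)) (ℕₚ.*-comm M 2) (*-monoʳ-∣ M (m∣m*n q))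

  τ-M*odd-contributing : ∀ w′ t → let j = suc (2 ℕ.* w′) in
                         tri (M ℕ.* j) ℕ.+ M ℕ.* j ℕ.* t ≡ m → τ (M ℕ.* j) ≤ τ j
  τ-M*odd-contributing w′ t e with odd-rescale (2 ^ v) {{ℕₚ.m^n≢0 2 v}} w′ t
  ... | D , e′ = begin
    τ (M ℕ.* j)                                          ≡⟨ cong (term k (M ℕ.* j)) e ⟨
    term k (M ℕ.* j) (tri (M ℕ.* j) ℕ.+ M ℕ.* j ℕ.* t)  ≡⟨ term-value k (M ℕ.* j) {{ℕₚ.m*n≢0 M j}} t ⟩
    eulerianRatio k 1 t                                  ≤⟨ increasing-+ (eulerianRatio-increasing k) t D ⟩
    eulerianRatio k 1 (t ℕ.+ D)                          ≡⟨ term-value k j (t ℕ.+ D) ⟨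
    term k j (tri j ℕ.+ j ℕ.* (t ℕ.+ D))                 ≡⟨ cong (term k j) (trans (sym e′) e) ⟩
    τ j                                                  ∎
    where
    open ℤₚ.≤-Reasoning
    j = suc (2 ℕ.* w′)

  τ-M*odd : ∀ w′ → τ (M ℕ.* suc (2 ℕ.* w′)) ≤ τ (suc (2 ℕ.* w′))
  τ-M*odd w′ with term-support k (M ℕ.* suc (2 ℕ.* w′)) m
  ... | inj₁ τ≡0    = subst (_≤ τ (suc (2 ℕ.* w′))) (sym τ≡0) (nonNeg-term k _ m)
  ... | inj₂ (t , e) = τ-M*odd-contributing w′ t e

  τ-M*-dominated : ∀ x → τ (M ℕ.* x) ≤ oddPart τ x
  τ-M*-dominated x with evenOrOdd x
  ... | inj₁ (q , refl)  = ℤₚ.≤-reflexive (trans (τ-M*even q) (sym (oddPart-even τ (even⇒parity≡0ℙ (m∣m*n q)))))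
  ... | inj₂ (w′ , refl) = subst (τ (M ℕ.* _) ≤_) (sym (oddPart-odd τ (parity-odd w′))) (τ-M*odd w′)

  h-nonNeg : + 0 ≤ h k m
  h-nonNeg = begin
    + 0
      ≤⟨ sumℤ-nonNeg m (λ j _ → pair-nonNeg j) ⟩
    sumℤ m (λ j → oddPart τ (suc j) - evenPart τ (M ℕ.* suc j))
      ≡⟨ sumℤ-sub m ⟩
    sumℤ m (oddPart τ ∘ suc) - sumℤ m (λ j → evenPart τ (M ℕ.* suc j))
      ≡⟨ cong (_-_ (sumℤ m (oddPart τ ∘ suc))) evenParts-reindex ⟨
    sumℤ m (oddPart τ ∘ suc) - sumℤ m (evenPart τ ∘ suc)
      ≡⟨ sumℤ-sub m ⟨
    sumℤ m (λ j → oddPart τ (suc j) - evenPart τ (suc j))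
      ≡⟨ sumℤ-cong m (λ j _ → sgn-split (suc j) (τ (suc j))) ⟨
    h k m
      ∎
    where
    open ℤₚ.≤-Reasoning
    pair-nonNeg : ∀ j → + 0 ≤ oddPart τ (suc j) - evenPart τ (M ℕ.* suc j)
    pair-nonNeg j = ℤₚ.i≤j⇒0≤j-i
      (subst (_≤ oddPart τ (suc j)) (sym (evenPart-M* (suc j))) (τ-M*-dominated (suc j)))

lemma3 : (k m : ℕ) → + 0 ≤ h k m
lemma3 k zero    = +≤+ z≤n
lemma3 k (suc m) with odd-part m
... | v , w , m≡ = OddEvenPairing.h-nonNeg k (suc m) v w m≡
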